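{- For integers $n\ge i\ge 0$, let $L^{\mathbf{uh}}_{n,i}$ be the number of G-Motzkin paths of length $n$ with exactly $i$ occurrences of $\mathbf{uh}$ (a $\mathbf{u}$-step immediately followed by an $\mathbf{h}$-step). Then \[ L^{\mathbf{uh}}_{n,i}=\sum_{k=i}^{n-i}\sum_{j=0}^{n-k-i}\binom{k}{i}\binom{k}{j}\binom{n-j}{n-k-i-j}C_k, \] where $C_k=\frac{1}{k+1}\binom{2k}{k}$ is the $k$-th Catalan number.
   Context: A G-Motzkin path of length $n$ is a lattice path from $(0,0)$ to $(n,0)$ that never goes below the $x$-axis and consists of up steps $\mathbf{u}=(1,1)$, down steps $\mathbf{d}=(1,-1)$, horizontal steps $\mathbf{h}=(1,0)$ and vertical steps $\mathbf{v}=(0,-1)$; it is encoded as the word of its steps. -}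

module Defs where

open import Data.Nat using (ℕ; zero; suc; _+_; _*_; _∸_; _/_)
open import Data.Nat.Combinatorics using (_C_)
open import Data.List using (List; []; _∷_)
open import Data.Product using (_×_)
open import Relation.Binary.PropositionalEquality using (_≡_)

-- Steps of a G-Motzkin path: u = (1,1), d = (1,-1), h = (1,0), v = (0,-1)
data Step : Set where
  u d h v : Step

-- Walk m w : starting at height m, the step word w never goes below the
-- x-axis and ends at height 0.
data Walk : ℕ → List Step → Set where
  done  : Walk zero []
  stepU : ∀ {m w} → Walk (suc m) w → Walk m (u ∷ w)
  stepD : ∀ {m w} → Walk m w → Walk (suc m) (d ∷ w)
  stepH : ∀ {m w} → Walk m w → Walk m (h ∷ w)
  stepV : ∀ {m w} → Walk m w → Walk (suc m) (v ∷ w)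

xlength : List Step → ℕ
xlength []      = 0
xlength (v ∷ w) = xlength w
xlength (_ ∷ w) = suc (xlength w)

GMotzkin : ℕ → List Step → Set
GMotzkin n w = Walk zero w × xlength w ≡ n

countUH : List Step → ℕ
countUH []            = 0
countUH (u ∷ h ∷ w)   = suc (countUH (h ∷ w))
countUH (_ ∷ w)       = countUH w

-- Σ_{k=a}^{b} f k  (empty when b < a)
sumFromTo : ℕ → ℕ → (ℕ → ℕ) → ℕ
sumFromTo a b f = go a (suc b ∸ a)
  where
  go : ℕ → ℕ → ℕ
  go s zero    = 0
  go s (suc c) = f s + go (suc s) c

catalan : ℕ → ℕ
catalan k = ((2 * k) C k) / suc k

rhs : ℕ → ℕ → ℕ
rhs n i = sumFromTo i (n ∸ i) λ k →
            sumFromTo 0 (n ∸ k ∸ i) λ j →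
              (k C i) * (k C j) * ((n ∸ j) C (n ∸ k ∸ i ∸ j)) * catalan k

-- Erasing the flat steps of a G-Motzkin path and then turning its vertical steps into
-- down steps leaves a Dyck path of semilength k, the number of up steps (C_k choices).
-- The path is recovered by choosing which j of the k down steps were genuine down steps
-- (binom(k,j) choices) and re-inserting the n-k-j flat steps so that exactly i of them
-- directly follow an up step: choose those i up steps (binom(k,i)) and distribute the flat
-- steps over the k+i+1 gaps after a descent, at the start, or after a chosen up step, the
-- last i being nonempty (binom(n-j, n-k-i-j) ways). So the paths form a disjoint union,
-- over k and j, of products of these three choices.
module Submission where

open import Defs
open import Data.Bool using (Bool; true; false; if_then_else_)
open import Data.Empty using (⊥-elim)
open import Data.List using (List; []; _∷_; _++_; map; concatMap; length; head)
open import Data.List.Properties using (length-map; length-++; ++-identityʳ; ∷-injectiveˡ; ∷-injectiveʳ)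
open import Data.List.Membership.Propositional using (_∈_; find; lose)
open import Data.List.Membership.Propositional.Properties
  using (∈-map⁺; ∈-map⁻; ∈-++⁺ˡ; ∈-++⁺ʳ; ∈-++⁻; ∈-concatMap⁺; ∈-concatMap⁻)
open import Data.List.Relation.Unary.All as All using (All; []; _∷_)
open import Data.List.Relation.Unary.AllPairs using ([]; _∷_)
open import Data.List.Relation.Unary.Any using (here; there)
open import Data.List.Relation.Unary.Unique.Propositional using (Unique)
import Data.List.Relation.Unary.Unique.Propositional.Properties as Unique
open import Data.Maybe using (just)
open import Data.Nat using (ℕ; zero; suc; _+_; _*_; _∸_; _/_; _≤_; _<_; z≤n; s≤s; s≤s⁻¹; z<s)
open import Data.Nat.Properties
open import Data.Nat.Combinatorics using (_C_; nCk+nC[k+1]≡[n+1]C[k+1]; nC1≡n; k>n⇒nCk≡0)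
open import Data.Nat.DivMod using (m*n/n≡m)
open import Data.Nat.ListAction using (sum)
open import Data.Nat.Tactic.RingSolver using (solve-∀)
open import Data.Product using (Σ; ∃-syntax; _×_; _,_; proj₁; proj₂)
open import Data.Sum using (inj₁; inj₂)
open import Function using (_∘_)
open import Relation.Binary.PropositionalEquality

open ≡-Reasoning

record Enumerates {A : Set} (P : A → Set) (xs : List A) : Set where
  field
    unique   : Unique xs
    sound    : ∀ {x} → x ∈ xs → P x
    complete : ∀ {x} → P x → x ∈ xs

open Enumerates

module _ {A B : Set} {F : B → List A} where

  Unique-concatMap : ∀ {bs} → Unique bs → (∀ b → Unique (F b)) →
                     (∀ {b b′ x} → x ∈ F b → x ∈ F b′ → b ≡ b′) →
                     Unique (concatMap F bs)
  Unique-concatMap {[]}     []              _  _     = []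
  Unique-concatMap {b ∷ bs} (b∉bs ∷ bs!) F! fibres =
    Unique.++⁺ (F! b) (Unique-concatMap bs! F! fibres) λ (x∈Fb , x∈rest) →
      let b′ , b′∈bs , x∈Fb′ = find (∈-concatMap⁻ F x∈rest)
      in All.lookup b∉bs b′∈bs (fibres x∈Fb x∈Fb′)

  concatMap-enumerates : ∀ {P : B → Set} {Q : B → A → Set} {bs} →
    Enumerates P bs → (∀ b → Enumerates (Q b) (F b)) →
    (∀ {b b′ x} → Q b x → Q b′ x → b ≡ b′) →
    Enumerates (λ x → ∃[ b ] P b × Q b x) (concatMap F bs)
  concatMap-enumerates {bs = bs} base fibre disjoint = record
    { unique   = Unique-concatMap (unique base) (unique ∘ fibre)
                   λ {b} {b′} p q → disjoint (sound (fibre b) p) (sound (fibre b′) q)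
    ; sound    = λ x∈ → let b , b∈bs , x∈Fb = find (∈-concatMap⁻ F {xs = bs} x∈)
                        in b , sound base b∈bs , sound (fibre b) x∈Fb
    ; complete = λ (b , pb , qbx) →
                   ∈-concatMap⁺ F (lose (complete base pb) (complete (fibre b) qbx))
    }

  length-concatMap : ∀ {g : B → ℕ} bs → (∀ {b} → b ∈ bs → length (F b) ≡ g b) →
                     length (concatMap F bs) ≡ sum (map g bs)
  length-concatMap []       _   = refl
  length-concatMap (b ∷ bs) len =
    trans (length-++ (F b)) (cong₂ _+_ (len (here refl)) (length-concatMap bs (len ∘ there)))

  length-concatMap-const : ∀ {c} bs → (∀ {b} → b ∈ bs → length (F b) ≡ c) →
                           length (concatMap F bs) ≡ length bs * c
  length-concatMap-const []       _   = refl
  length-concatMap-const (b ∷ bs) len =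
    trans (length-++ (F b)) (cong₂ _+_ (len (here refl)) (length-concatMap-const bs (len ∘ there)))

Unique-map-∷ : ∀ {A : Set} (x : A) {ws} → Unique ws → Unique (map (x ∷_) ws)
Unique-map-∷ x = Unique.map⁺ ∷-injectiveʳ

Unique-branches : ∀ {A : Set} {x y : A} {ws vs} → x ≢ y → Unique ws → Unique vs →
                  Unique (map (x ∷_) ws ++ map (y ∷_) vs)
Unique-branches {x = x} {y} x≢y ws! vs! =
  Unique.++⁺ (Unique-map-∷ x ws!) (Unique-map-∷ y vs!) λ (p , q) →
    let _ , _ , z≡x∷ = ∈-map⁻ (x ∷_) p
        _ , _ , z≡y∷ = ∈-map⁻ (y ∷_) q
    in x≢y (∷-injectiveˡ (trans (sym z≡x∷) z≡y∷))

upFrom : ℕ → ℕ → List ℕ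
upFrom s zero    = []
upFrom s (suc c) = s ∷ upFrom (suc s) c

range : ℕ → ℕ → List ℕ
range a b = upFrom a (suc b ∸ a)

∈-upFrom⁻ : ∀ s c {x} → x ∈ upFrom s c → s ≤ x × x < s + c
∈-upFrom⁻ s (suc c) (here refl) = ≤-refl , m<m+n s z<s
∈-upFrom⁻ s (suc c) {x} (there x∈) =
  let s<x , x<1+s+c = ∈-upFrom⁻ (suc s) c x∈ in <⇒≤ s<x , subst (x <_) (sym (+-suc s c)) x<1+s+c

∈-upFrom⁺ : ∀ s c {x} → s ≤ x → x < s + c → x ∈ upFrom s c
∈-upFrom⁺ s zero    s≤x x<s+0 = ⊥-elim (<-irrefl refl (<-≤-trans x<s+0 (subst (_≤ _) (sym (+-identityʳ s)) s≤x)))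
∈-upFrom⁺ s (suc c) {x} s≤x x<s+c with m≤n⇒m<n∨m≡n s≤x
... | inj₂ refl = here refl
... | inj₁ s<x  = there (∈-upFrom⁺ (suc s) c s<x (subst (x <_) (+-suc s c) x<s+c))

Unique-upFrom : ∀ s c → Unique (upFrom s c)
Unique-upFrom s zero    = []
Unique-upFrom s (suc c) =
  All.tabulate (λ x∈ s≡x → <-irrefl s≡x (proj₁ (∈-upFrom⁻ (suc s) c x∈))) ∷ Unique-upFrom (suc s) c

range-enumerates : ∀ a b → Enumerates (λ x → a ≤ x × x ≤ b) (range a b)
range-enumerates a b = record
  { unique   = Unique-upFrom a (suc b ∸ a)
  ; sound    = λ x∈ → let a≤x , x<a+c = ∈-upFrom⁻ a (suc b ∸ a) x∈ in a≤x , s≤s⁻¹ (x<1+b a≤x x<a+c)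
  ; complete = λ {x} (a≤x , x≤b) → ∈-upFrom⁺ a (suc b ∸ a) a≤x
      (subst (x <_) (sym (m+[n∸m]≡n (≤-trans a≤x (m≤n⇒m≤1+n x≤b)))) (s≤s x≤b))
  }
  where
  x<1+b : ∀ {x} → a ≤ x → x < a + (suc b ∸ a) → x < suc b
  x<1+b {x} a≤x x< with ≤-total a (suc b)
  ... | inj₁ a≤1+b = subst (x <_) (m+[n∸m]≡n a≤1+b) x<
  ... | inj₂ 1+b≤a = ⊥-elim (<-irrefl refl (<-≤-trans x<
                       (subst (_≤ x) (sym (trans (cong (a +_) (m≤n⇒m∸n≡0 1+b≤a)) (+-identityʳ a))) a≤x)))

sumFromTo-unfold : ∀ f {a b} → a ≤ b → sumFromTo a b f ≡ f a + sumFromTo (suc a) b f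
sumFromTo-unfold f {a} a≤b rewrite +-∸-assoc 1 a≤b = refl

sum-map-range : ∀ f a b → sum (map f (range a b)) ≡ sumFromTo a b f
sum-map-range f a b with ≤-total (suc b) a
... | inj₁ 1+b≤a rewrite m≤n⇒m∸n≡0 1+b≤a = refl
... | inj₂ a≤1+b = sum-upFrom (suc b ∸ a) a (m∸n+n≡m a≤1+b)
  where
  sum-upFrom : ∀ c s → c + s ≡ suc b → sum (map f (upFrom s c)) ≡ sumFromTo s b f
  sum-upFrom zero    .(suc b) refl rewrite n∸n≡0 b = refl
  sum-upFrom (suc c) s c+s≡b = trans (cong (f s +_) (sum-upFrom c (suc s) (trans (+-suc c s) c+s≡b)))
                             (sym (sumFromTo-unfold f (s≤s⁻¹ (subst (suc s ≤_) c+s≡b (s≤s (m≤n+m s c))))))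

ups downs flats descents : List Step → ℕ
ups []      = 0
ups (u ∷ w) = suc (ups w)
ups (_ ∷ w) = ups w

downs []      = 0
downs (d ∷ w) = suc (downs w)
downs (_ ∷ w) = downs w

flats []      = 0
flats (h ∷ w) = suc (flats w)
flats (_ ∷ w) = flats w

descents []      = 0
descents (d ∷ w) = suc (descents w)
descents (v ∷ w) = suc (descents w)
descents (_ ∷ w) = descents w

dropFlats : List Step → List Step
dropFlats []      = []
dropFlats (h ∷ w) = dropFlats w
dropFlats (x ∷ w) = x ∷ dropFlats w

recolour : List Step → List Step
recolour []      = []
recolour (v ∷ w) = d ∷ recolour w
recolour (x ∷ w) = x ∷ recolour w

data UpOrDown : Step → Set where
  up   : UpOrDown u
  down : UpOrDown d

xlength≡ups+downs+flats : ∀ w → xlength w ≡ ups w + downs w + flats w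
xlength≡ups+downs+flats []      = refl
xlength≡ups+downs+flats (u ∷ w) = cong suc (xlength≡ups+downs+flats w)
xlength≡ups+downs+flats (d ∷ w) =
  trans (cong suc (xlength≡ups+downs+flats w)) (cong (_+ flats w) (sym (+-suc (ups w) (downs w))))
xlength≡ups+downs+flats (h ∷ w) =
  trans (cong suc (xlength≡ups+downs+flats w)) (sym (+-suc (ups w + downs w) (flats w)))
xlength≡ups+downs+flats (v ∷ w) = xlength≡ups+downs+flats w

Walk⇒height+ups≡descents : ∀ {m w} → Walk m w → m + ups w ≡ descents w
Walk⇒height+ups≡descents done                     = refl
Walk⇒height+ups≡descents {m} {u ∷ w} (stepU walk) = trans (+-suc m (ups w)) (Walk⇒height+ups≡descents walk)
Walk⇒height+ups≡descents (stepD walk)             = cong suc (Walk⇒height+ups≡descents walk)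
Walk⇒height+ups≡descents (stepH walk)             = Walk⇒height+ups≡descents walk
Walk⇒height+ups≡descents (stepV walk)             = cong suc (Walk⇒height+ups≡descents walk)

Walk-dropFlats⁺ : ∀ {m} w → Walk m w → Walk m (dropFlats w)
Walk-dropFlats⁺ []      done         = done
Walk-dropFlats⁺ (u ∷ w) (stepU walk) = stepU (Walk-dropFlats⁺ w walk)
Walk-dropFlats⁺ (d ∷ w) (stepD walk) = stepD (Walk-dropFlats⁺ w walk)
Walk-dropFlats⁺ (h ∷ w) (stepH walk) = Walk-dropFlats⁺ w walk
Walk-dropFlats⁺ (v ∷ w) (stepV walk) = stepV (Walk-dropFlats⁺ w walk)

Walk-dropFlats⁻ : ∀ {m} w → Walk m (dropFlats w) → Walk m w
Walk-dropFlats⁻ []      done         = done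
Walk-dropFlats⁻ (u ∷ w) (stepU walk) = stepU (Walk-dropFlats⁻ w walk)
Walk-dropFlats⁻ (d ∷ w) (stepD walk) = stepD (Walk-dropFlats⁻ w walk)
Walk-dropFlats⁻ (h ∷ w) walk         = stepH (Walk-dropFlats⁻ w walk)
Walk-dropFlats⁻ (v ∷ w) (stepV walk) = stepV (Walk-dropFlats⁻ w walk)

Walk-recolour⁺ : ∀ {m} w → Walk m w → Walk m (recolour w)
Walk-recolour⁺ []      done         = done
Walk-recolour⁺ (u ∷ w) (stepU walk) = stepU (Walk-recolour⁺ w walk)
Walk-recolour⁺ (d ∷ w) (stepD walk) = stepD (Walk-recolour⁺ w walk)
Walk-recolour⁺ (h ∷ w) (stepH walk) = stepH (Walk-recolour⁺ w walk)
Walk-recolour⁺ (v ∷ w) (stepV walk) = stepD (Walk-recolour⁺ w walk)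

Walk-recolour⁻ : ∀ {m} w → Walk m (recolour w) → Walk m w
Walk-recolour⁻ []      done         = done
Walk-recolour⁻ (u ∷ w) (stepU walk) = stepU (Walk-recolour⁻ w walk)
Walk-recolour⁻ (d ∷ w) (stepD walk) = stepD (Walk-recolour⁻ w walk)
Walk-recolour⁻ (h ∷ w) (stepH walk) = stepH (Walk-recolour⁻ w walk)
Walk-recolour⁻ (v ∷ w) (stepD walk) = stepV (Walk-recolour⁻ w walk)

ups-dropFlats : ∀ w → ups (dropFlats w) ≡ ups w
ups-dropFlats []      = refl
ups-dropFlats (u ∷ w) = cong suc (ups-dropFlats w)
ups-dropFlats (d ∷ w) = ups-dropFlats w
ups-dropFlats (h ∷ w) = ups-dropFlats w
ups-dropFlats (v ∷ w) = ups-dropFlats w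

downs-dropFlats : ∀ w → downs (dropFlats w) ≡ downs w
downs-dropFlats []      = refl
downs-dropFlats (u ∷ w) = downs-dropFlats w
downs-dropFlats (d ∷ w) = cong suc (downs-dropFlats w)
downs-dropFlats (h ∷ w) = downs-dropFlats w
downs-dropFlats (v ∷ w) = downs-dropFlats w

ups-recolour : ∀ w → ups (recolour w) ≡ ups w
ups-recolour []      = refl
ups-recolour (u ∷ w) = cong suc (ups-recolour w)
ups-recolour (d ∷ w) = ups-recolour w
ups-recolour (h ∷ w) = ups-recolour w
ups-recolour (v ∷ w) = ups-recolour w

descents-recolour : ∀ w → descents (recolour w) ≡ descents w
descents-recolour []      = refl
descents-recolour (u ∷ w) = descents-recolour w
descents-recolour (d ∷ w) = cong suc (descents-recolour w)
descents-recolour (h ∷ w) = descents-recolour w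
descents-recolour (v ∷ w) = cong suc (descents-recolour w)

All-UpOrDown-recolour-dropFlats : ∀ w → All UpOrDown (recolour (dropFlats w))
All-UpOrDown-recolour-dropFlats []      = []
All-UpOrDown-recolour-dropFlats (u ∷ w) = up ∷ All-UpOrDown-recolour-dropFlats w
All-UpOrDown-recolour-dropFlats (d ∷ w) = down ∷ All-UpOrDown-recolour-dropFlats w
All-UpOrDown-recolour-dropFlats (h ∷ w) = All-UpOrDown-recolour-dropFlats w
All-UpOrDown-recolour-dropFlats (v ∷ w) = down ∷ All-UpOrDown-recolour-dropFlats w

All-≢h-dropFlats : ∀ w → All (_≢ h) (dropFlats w)
All-≢h-dropFlats []      = []
All-≢h-dropFlats (u ∷ w) = (λ ()) ∷ All-≢h-dropFlats w
All-≢h-dropFlats (d ∷ w) = (λ ()) ∷ All-≢h-dropFlats w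
All-≢h-dropFlats (h ∷ w) = All-≢h-dropFlats w
All-≢h-dropFlats (v ∷ w) = (λ ()) ∷ All-≢h-dropFlats w

countUH≤ups : ∀ w → countUH w ≤ ups w
countUH≤ups []          = z≤n
countUH≤ups (u ∷ [])    = z≤n
countUH≤ups (u ∷ u ∷ w) = m≤n⇒m≤1+n (countUH≤ups (u ∷ w))
countUH≤ups (u ∷ d ∷ w) = m≤n⇒m≤1+n (countUH≤ups w)
countUH≤ups (u ∷ h ∷ w) = s≤s (countUH≤ups w)
countUH≤ups (u ∷ v ∷ w) = m≤n⇒m≤1+n (countUH≤ups w)
countUH≤ups (d ∷ w)     = countUH≤ups w
countUH≤ups (h ∷ w)     = countUH≤ups w
countUH≤ups (v ∷ w)     = countUH≤ups w

countUH≤flats : ∀ w → countUH w ≤ flats w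
countUH≤flats []          = z≤n
countUH≤flats (u ∷ [])    = z≤n
countUH≤flats (u ∷ u ∷ w) = countUH≤flats (u ∷ w)
countUH≤flats (u ∷ d ∷ w) = countUH≤flats w
countUH≤flats (u ∷ h ∷ w) = s≤s (countUH≤flats w)
countUH≤flats (u ∷ v ∷ w) = countUH≤flats w
countUH≤flats (d ∷ w)     = countUH≤flats w
countUH≤flats (h ∷ w)     = m≤n⇒m≤1+n (countUH≤flats w)
countUH≤flats (v ∷ w)     = countUH≤flats w

[1+r]*[1+n]C[1+r]≡[1+n]*nCr : ∀ n r → suc r * (suc n C suc r) ≡ suc n * (n C r)
[1+r]*[1+n]C[1+r]≡[1+n]*nCr zero    zero    = refl
[1+r]*[1+n]C[1+r]≡[1+n]*nCr zero    (suc r) = *-zeroʳ (suc (suc r))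
[1+r]*[1+n]C[1+r]≡[1+n]*nCr (suc n) zero    =
  trans (+-identityʳ _) (trans (nC1≡n (suc (suc n))) (sym (*-identityʳ (suc (suc n)))))
[1+r]*[1+n]C[1+r]≡[1+n]*nCr (suc n) (suc r) = begin
  (2 + r) * (suc (suc n) C (2 + r))
    ≡⟨ cong ((2 + r) *_) (nCk+nC[k+1]≡[n+1]C[k+1] (suc n) (suc r)) ⟨
  (2 + r) * (X + Y)
    ≡⟨ regroup r X Y ⟩
  X + ((1 + r) * X + (2 + r) * Y)
    ≡⟨ cong (X +_) (cong₂ _+_ ([1+r]*[1+n]C[1+r]≡[1+n]*nCr n r) ([1+r]*[1+n]C[1+r]≡[1+n]*nCr n (suc r))) ⟩
  X + ((1 + n) * (n C r) + (1 + n) * (n C suc r))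
    ≡⟨ cong (X +_) (*-distribˡ-+ (suc n) (n C r) (n C suc r)) ⟨
  X + (1 + n) * (n C r + n C suc r)
    ≡⟨ cong (λ z → X + (1 + n) * z) (nCk+nC[k+1]≡[n+1]C[k+1] n r) ⟩
  X + (1 + n) * X
    ∎
  where
  X = suc n C suc r
  Y = suc n C suc (suc r)
  regroup : ∀ r X Y → (2 + r) * (X + Y) ≡ X + ((1 + r) * X + (2 + r) * Y)
  regroup = solve-∀

[1+r]*nC[1+r]≡[n∸r]*nCr : ∀ n r → suc r * (n C suc r) ≡ (n ∸ r) * (n C r)
[1+r]*nC[1+r]≡[n∸r]*nCr n r = begin
  suc r * (n C suc r)                          ≡⟨ m+n∸n≡m (suc r * (n C suc r)) (suc r * (n C r)) ⟨
  suc r * (n C suc r) + suc r * (n C r) ∸ suc r * (n C r)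
                                               ≡⟨ cong (_∸ suc r * (n C r)) absorbed ⟩
  suc n * (n C r) ∸ suc r * (n C r)            ≡⟨ *-distribʳ-∸ (n C r) (suc n) (suc r) ⟨
  (n ∸ r) * (n C r)                            ∎
  where
  absorbed : suc r * (n C suc r) + suc r * (n C r) ≡ suc n * (n C r)
  absorbed = begin
    suc r * (n C suc r) + suc r * (n C r)  ≡⟨ +-comm (suc r * (n C suc r)) _ ⟩
    suc r * (n C r) + suc r * (n C suc r)  ≡⟨ *-distribˡ-+ (suc r) (n C r) (n C suc r) ⟨
    suc r * (n C r + n C suc r)            ≡⟨ cong (suc r *_) (nCk+nC[k+1]≡[n+1]C[k+1] n r) ⟩
    suc r * (suc n C suc r)                ≡⟨ [1+r]*[1+n]C[1+r]≡[1+n]*nCr n r ⟩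
    suc n * (n C r)                        ∎

pascal-step : ∀ {K R A} x y → x + K C suc R ≡ K C A → y + K C R ≡ K C suc A →
              (x + y) + suc K C suc R ≡ suc K C suc A
pascal-step {K} {R} {A} x y eqˣ eqʸ = begin
  (x + y) + suc K C suc R              ≡⟨ cong ((x + y) +_) (nCk+nC[k+1]≡[n+1]C[k+1] K R) ⟨
  (x + y) + (K C R + K C suc R)        ≡⟨ regroup x y (K C R) (K C suc R) ⟩
  (x + K C suc R) + (y + K C R)        ≡⟨ cong₂ _+_ eqˣ eqʸ ⟩
  K C A + K C suc A                    ≡⟨ nCk+nC[k+1]≡[n+1]C[k+1] K A ⟩
  suc K C suc A                        ∎
  where
  regroup : ∀ x y p q → (x + y) + (p + q) ≡ (x + q) + (y + p)
  regroup = solve-∀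

multichoose : ℕ → ℕ → ℕ
multichoose p       zero    = 1
multichoose zero    (suc r) = 0
multichoose (suc p) (suc r) = multichoose p (suc r) + multichoose (suc p) r

-- the number of ways to put T balls into p boxes, i given ones of which must be nonempty
placements : ℕ → ℕ → ℕ → ℕ
placements p zero    T       = multichoose p T
placements p (suc i) zero    = 0
placements p (suc i) (suc T) = placements p i T

multichoose[1+p]≡C : ∀ p r → multichoose (suc p) r ≡ (r + p) C r
multichoose[1+p]≡C p       zero    = refl
multichoose[1+p]≡C zero    (suc r) = begin
  multichoose 1 r                  ≡⟨ multichoose[1+p]≡C zero r ⟩
  (r + 0) C r                      ≡⟨ +-identityʳ _ ⟨
  (r + 0) C r + 0                  ≡⟨ cong ((r + 0) C r +_) (k>n⇒nCk≡0 (s≤s (≤-reflexive (+-identityʳ r)))) ⟨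
  (r + 0) C r + (r + 0) C suc r    ≡⟨ nCk+nC[k+1]≡[n+1]C[k+1] (r + 0) r ⟩
  suc (r + 0) C suc r              ∎
multichoose[1+p]≡C (suc p) (suc r) = begin
  multichoose (suc p) (suc r) + multichoose (2 + p) r
    ≡⟨ cong₂ _+_ (multichoose[1+p]≡C p (suc r)) (multichoose[1+p]≡C (suc p) r) ⟩
  (suc r + p) C suc r + (r + suc p) C r
    ≡⟨ cong (λ z → z C suc r + (r + suc p) C r) (+-suc r p) ⟨
  (r + suc p) C suc r + (r + suc p) C r
    ≡⟨ +-comm ((r + suc p) C suc r) _ ⟩
  (r + suc p) C r + (r + suc p) C suc r
    ≡⟨ nCk+nC[k+1]≡[n+1]C[k+1] (r + suc p) r ⟩
  suc (r + suc p) C suc r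
    ∎

placements-empty : ∀ p q i → placements p i 0 ≡ placements q i 0
placements-empty p q zero    = refl
placements-empty p q (suc i) = refl

placements-pascal : ∀ p i T → placements (suc p) i (suc T) ≡ placements (suc p) i T + placements p i (suc T)
placements-pascal p zero    T       = +-comm (multichoose p (suc T)) _
placements-pascal p (suc i) zero    = placements-empty (suc p) p i
placements-pascal p (suc i) (suc T) = placements-pascal p i T

placements-reserved : ∀ p i r → placements p i (i + r) ≡ multichoose p r
placements-reserved p zero    r = refl
placements-reserved p (suc i) r = placements-reserved p i r

-- Dyck paths

Ballot : ℕ → ℕ → List Step → Set
Ballot m a w = Walk m w × All UpOrDown w × ups w ≡ a

ballotPaths : ℕ → ℕ → List (List Step)
ballotPaths zero    zero    = [] ∷ []
ballotPaths (suc m) zero    = map (d ∷_) (ballotPaths m zero)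
ballotPaths zero    (suc a) = map (u ∷_) (ballotPaths 1 a)
ballotPaths (suc m) (suc a) = map (u ∷_) (ballotPaths (suc (suc m)) a) ++ map (d ∷_) (ballotPaths m (suc a))

Ballot-u : ∀ {m a w} → Ballot (suc m) a w → Ballot m (suc a) (u ∷ w)
Ballot-u (walk , ud , refl) = stepU walk , up ∷ ud , refl

Ballot-d : ∀ {m a w} → Ballot m a w → Ballot (suc m) a (d ∷ w)
Ballot-d (walk , ud , refl) = stepD walk , down ∷ ud , refl

ballotPaths-sound : ∀ m a {w} → w ∈ ballotPaths m a → Ballot m a w
ballotPaths-sound zero    zero    (here refl) = done , [] , refl
ballotPaths-sound (suc m) zero    w∈ with ∈-map⁻ (d ∷_) w∈
... | _ , w′∈ , refl = Ballot-d (ballotPaths-sound m zero w′∈)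
ballotPaths-sound zero    (suc a) w∈ with ∈-map⁻ (u ∷_) w∈
... | _ , w′∈ , refl = Ballot-u (ballotPaths-sound 1 a w′∈)
ballotPaths-sound (suc m) (suc a) w∈ with ∈-++⁻ (map (u ∷_) (ballotPaths (suc (suc m)) a)) w∈
... | inj₁ w∈ᵤ with ∈-map⁻ (u ∷_) w∈ᵤ
...   | _ , w′∈ , refl = Ballot-u (ballotPaths-sound (suc (suc m)) a w′∈)
ballotPaths-sound (suc m) (suc a) w∈ | inj₂ w∈d with ∈-map⁻ (d ∷_) w∈d
...   | _ , w′∈ , refl = Ballot-d (ballotPaths-sound m (suc a) w′∈)

∈-ballotPaths-u : ∀ m a {w} → w ∈ ballotPaths (suc m) a → u ∷ w ∈ ballotPaths m (suc a)
∈-ballotPaths-u zero    a w∈ = ∈-map⁺ (u ∷_) w∈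
∈-ballotPaths-u (suc m) a w∈ = ∈-++⁺ˡ (∈-map⁺ (u ∷_) w∈)

∈-ballotPaths-d : ∀ m a {w} → w ∈ ballotPaths m a → d ∷ w ∈ ballotPaths (suc m) a
∈-ballotPaths-d m zero    w∈ = ∈-map⁺ (d ∷_) w∈
∈-ballotPaths-d m (suc a) w∈ = ∈-++⁺ʳ (map (u ∷_) (ballotPaths (suc (suc m)) a)) (∈-map⁺ (d ∷_) w∈)

ballotPaths-complete : ∀ {m w} → Walk m w → All UpOrDown w → w ∈ ballotPaths m (ups w)
ballotPaths-complete done         []          = here refl
ballotPaths-complete {m}     {u ∷ w} (stepU walk) (up ∷ ud)   = ∈-ballotPaths-u m (ups w) (ballotPaths-complete walk ud)
ballotPaths-complete {suc m} {d ∷ w} (stepD walk) (down ∷ ud) = ∈-ballotPaths-d m (ups w) (ballotPaths-complete walk ud)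

Unique-ballotPaths : ∀ m a → Unique (ballotPaths m a)
Unique-ballotPaths zero    zero    = [] ∷ []
Unique-ballotPaths (suc m) zero    = Unique-map-∷ d (Unique-ballotPaths m zero)
Unique-ballotPaths zero    (suc a) = Unique-map-∷ u (Unique-ballotPaths 1 a)
Unique-ballotPaths (suc m) (suc a) =
  Unique-branches (λ ()) (Unique-ballotPaths (suc (suc m)) a) (Unique-ballotPaths m (suc a))

ballotPaths-enumerates : ∀ m a → Enumerates (Ballot m a) (ballotPaths m a)
ballotPaths-enumerates m a = record
  { unique   = Unique-ballotPaths m a
  ; sound    = ballotPaths-sound m a
  ; complete = λ { (walk , ud , refl) → ballotPaths-complete walk ud }
  }

-- The ballot theorem: C(N, R + 1) counts the u/d words that dip below the axis.
length-ballotPaths : ∀ m a {N R} → N ≡ a + a + m → R ≡ a + m →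
                     length (ballotPaths m a) + N C suc R ≡ N C a
length-ballotPaths zero    zero    refl refl = refl
length-ballotPaths (suc m) zero    refl refl = begin
  length (map (d ∷_) (ballotPaths m 0)) + suc m C suc (suc m)
    ≡⟨ cong₂ _+_ (length-map (d ∷_) (ballotPaths m 0)) (k>n⇒nCk≡0 (n<1+n (suc m))) ⟩
  length (ballotPaths m 0) + 0
    ≡⟨ cong (length (ballotPaths m 0) +_) (k>n⇒nCk≡0 (n<1+n m)) ⟨
  length (ballotPaths m 0) + m C suc m
    ≡⟨ length-ballotPaths m zero refl refl ⟩
  1
    ∎
length-ballotPaths zero    (suc a) refl refl =
  trans (cong (_+ suc K C suc (suc (a + 0))) (trans (length-map (u ∷_) (ballotPaths 1 a)) (sym (+-identityʳ _))))
        (pascal-step {K} {suc (a + 0)} {a} (length (ballotPaths 1 a)) 0 (length-ballotPaths 1 a (K≡ a) (R≡ a))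
                     (cong (λ r → K C suc r) (+-identityʳ a)))
  where
  K = a + suc a + 0
  K≡ : ∀ a → a + suc a + 0 ≡ a + a + 1
  K≡ = solve-∀
  R≡ : ∀ a → suc (a + 0) ≡ a + 1
  R≡ = solve-∀
length-ballotPaths (suc m) (suc a) refl refl =
  trans (cong (_+ suc K C suc (suc (a + suc m)))
              (trans (length-++ (map (u ∷_) afterUp)) (cong₂ _+_ (length-map (u ∷_) afterUp) (length-map (d ∷_) afterDown))))
        (pascal-step {K} {suc (a + suc m)} {a} (length afterUp) (length afterDown)
                     (length-ballotPaths (suc (suc m)) a (K≡ a m) (sym (+-suc a (suc m))))
                     (length-ballotPaths m (suc a) (K≡′ a m) (+-suc a m)))
  where
  afterUp   = ballotPaths (suc (suc m)) a
  afterDown = ballotPaths m (suc a)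
  K = a + suc a + suc m
  K≡ : ∀ a m → a + suc a + suc m ≡ a + a + suc (suc m)
  K≡ = solve-∀
  K≡′ : ∀ a m → a + suc a + suc m ≡ suc a + suc a + m
  K≡′ = solve-∀

length-dyckPaths : ∀ k → length (ballotPaths 0 k) ≡ catalan k
length-dyckPaths k = begin
  L                  ≡⟨ m*n/n≡m L (suc k) ⟨
  L * suc k / suc k  ≡⟨ cong (_/ suc k) L*[1+k]≡B ⟩
  B / suc k          ∎
  where
  L = length (ballotPaths 0 k)
  B = (2 * k) C k
  X = (2 * k) C suc k
  ballot : L + X ≡ B
  ballot = length-ballotPaths 0 k (double k) (sym (+-identityʳ k))
    where
    double : ∀ k → 2 * k ≡ k + k + 0
    double = solve-∀
  ratio : suc k * X ≡ k * B
  ratio = trans ([1+r]*nC[1+r]≡[n∸r]*nCr (2 * k) k) (cong (_* B) (trans (m+n∸m≡n k (k + 0)) (+-identityʳ k)))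
  L*[1+k]≡B : L * suc k ≡ B
  L*[1+k]≡B = +-cancelʳ-≡ (k * B) _ _ (begin
    L * suc k + k * B        ≡⟨ cong (L * suc k +_) ratio ⟨
    L * suc k + suc k * X    ≡⟨ factor L X k ⟩
    suc k * (L + X)          ≡⟨ cong (suc k *_) ballot ⟩
    suc k * B                ∎)
    where
    factor : ∀ L X k → L * suc k + suc k * X ≡ suc k * (L + X)
    factor = solve-∀

-- Colourings: turning some down steps of a Dyck path into vertical steps

Colouring : ℕ → List Step → List Step → Set
Colouring j D s = recolour s ≡ D × All (_≢ h) s × downs s ≡ j

colourings : List Step → ℕ → List (List Step)
colourings []      zero    = [] ∷ []
colourings []      (suc j) = []
colourings (u ∷ D) j       = map (u ∷_) (colourings D j)
colourings (d ∷ D) zero    = map (v ∷_) (colourings D zero)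
colourings (d ∷ D) (suc j) = map (d ∷_) (colourings D j) ++ map (v ∷_) (colourings D (suc j))
colourings (h ∷ D) j       = []
colourings (v ∷ D) j       = []

Colouring-u : ∀ {j D s} → Colouring j D s → Colouring j (u ∷ D) (u ∷ s)
Colouring-u (refl , nf , refl) = refl , (λ ()) ∷ nf , refl

Colouring-d : ∀ {j D s} → Colouring j D s → Colouring (suc j) (d ∷ D) (d ∷ s)
Colouring-d (refl , nf , refl) = refl , (λ ()) ∷ nf , refl

Colouring-v : ∀ {j D s} → Colouring j D s → Colouring j (d ∷ D) (v ∷ s)
Colouring-v (refl , nf , refl) = refl , (λ ()) ∷ nf , refl

colourings-sound : ∀ D j {s} → s ∈ colourings D j → Colouring j D s
colourings-sound []      zero    (here refl) = refl , [] , refl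
colourings-sound (u ∷ D) j       s∈ with ∈-map⁻ (u ∷_) s∈
... | _ , s′∈ , refl = Colouring-u (colourings-sound D j s′∈)
colourings-sound (d ∷ D) zero    s∈ with ∈-map⁻ (v ∷_) s∈
... | _ , s′∈ , refl = Colouring-v (colourings-sound D zero s′∈)
colourings-sound (d ∷ D) (suc j) s∈ with ∈-++⁻ (map (d ∷_) (colourings D j)) s∈
... | inj₁ s∈d with ∈-map⁻ (d ∷_) s∈d
...   | _ , s′∈ , refl = Colouring-d (colourings-sound D j s′∈)
colourings-sound (d ∷ D) (suc j) s∈ | inj₂ s∈v with ∈-map⁻ (v ∷_) s∈v
...   | _ , s′∈ , refl = Colouring-v (colourings-sound D (suc j) s′∈)

∈-colourings-v : ∀ D j {s} → s ∈ colourings D j → v ∷ s ∈ colourings (d ∷ D) j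
∈-colourings-v D zero    s∈ = ∈-map⁺ (v ∷_) s∈
∈-colourings-v D (suc j) s∈ = ∈-++⁺ʳ (map (d ∷_) (colourings D j)) (∈-map⁺ (v ∷_) s∈)

colourings-complete : ∀ {s} → All (_≢ h) s → s ∈ colourings (recolour s) (downs s)
colourings-complete {[]}    []           = here refl
colourings-complete {u ∷ s} (_ ∷ nf)     = ∈-map⁺ (u ∷_) (colourings-complete nf)
colourings-complete {d ∷ s} (_ ∷ nf)     = ∈-++⁺ˡ (∈-map⁺ (d ∷_) (colourings-complete nf))
colourings-complete {v ∷ s} (_ ∷ nf)     = ∈-colourings-v (recolour s) (downs s) (colourings-complete nf)
colourings-complete {h ∷ s} (h≢h ∷ _)    = ⊥-elim (h≢h refl)

Unique-colourings : ∀ D j → Unique (colourings D j)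
Unique-colourings []      zero    = [] ∷ []
Unique-colourings []      (suc j) = []
Unique-colourings (u ∷ D) j       = Unique-map-∷ u (Unique-colourings D j)
Unique-colourings (d ∷ D) zero    = Unique-map-∷ v (Unique-colourings D zero)
Unique-colourings (d ∷ D) (suc j) = Unique-branches (λ ()) (Unique-colourings D j) (Unique-colourings D (suc j))
Unique-colourings (h ∷ D) j       = []
Unique-colourings (v ∷ D) j       = []

colourings-enumerates : ∀ D j → Enumerates (Colouring j D) (colourings D j)
colourings-enumerates D j = record
  { unique   = Unique-colourings D j
  ; sound    = colourings-sound D j
  ; complete = λ { (refl , nf , refl) → colourings-complete nf }
  }

length-colourings : ∀ {D} j → All UpOrDown D → length (colourings D j) ≡ descents D C j
length-colourings {[]}    zero    []          = refl
length-colourings {[]}    (suc j) []          = refl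
length-colourings {u ∷ D} j       (up ∷ ud)   = trans (length-map (u ∷_) (colourings D j)) (length-colourings j ud)
length-colourings {d ∷ D} zero    (down ∷ ud) = trans (length-map (v ∷_) (colourings D zero)) (length-colourings zero ud)
length-colourings {d ∷ D} (suc j) (down ∷ ud) = begin
  length (map (d ∷_) (colourings D j) ++ map (v ∷_) (colourings D (suc j)))
    ≡⟨ length-++ (map (d ∷_) (colourings D j)) ⟩
  length (map (d ∷_) (colourings D j)) + length (map (v ∷_) (colourings D (suc j)))
    ≡⟨ cong₂ _+_ (trans (length-map (d ∷_) (colourings D j)) (length-colourings j ud))
                 (trans (length-map (v ∷_) (colourings D (suc j))) (length-colourings (suc j) ud)) ⟩
  descents D C j + descents D C suc j
    ≡⟨ nCk+nC[k+1]≡[n+1]C[k+1] (descents D) j ⟩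
  suc (descents D) C suc j
    ∎

-- Inserting flat steps

isUp : Step → Bool
isUp u = true
isUp _ = false

-- The flag f records that the word follows a u step.
Insertion : ℕ → ℕ → Bool → List Step → List Step → Set
Insertion T i f s w = dropFlats w ≡ s × flats w ≡ T × countUH (if f then u ∷ w else w) ≡ i

insertions : List Step → ℕ → ℕ → Bool → List (List Step)
flatFirst  : List Step → ℕ → ℕ → Bool → List (List Step)
stepFirst  : List Step → ℕ → ℕ → List (List Step)

insertions s T i f = stepFirst s T i ++ flatFirst s T i f

flatFirst s zero    i       f     = []
flatFirst s (suc T) i       false = map (h ∷_) (insertions s T i false)
flatFirst s (suc T) zero    true  = []
flatFirst s (suc T) (suc i) true  = map (h ∷_) (insertions s T i false)

stepFirst []      zero    zero    = [] ∷ []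
stepFirst []      zero    (suc i) = []
stepFirst []      (suc T) i       = []
stepFirst (h ∷ s) T       i       = []
stepFirst (x ∷ s) T       i       = map (x ∷_) (insertions s T i (isUp x))

Insertion-h : ∀ {T i f s w} → Insertion T i false s w →
              Insertion (suc T) (if f then suc i else i) f s (h ∷ w)
Insertion-h {f = false} (refl , refl , refl) = refl , refl , refl
Insertion-h {f = true}  (refl , refl , refl) = refl , refl , refl

Insertion-step : ∀ {x T i f s w} → x ≢ h → Insertion T i (isUp x) s w → Insertion T i f (x ∷ s) (x ∷ w)
Insertion-step {u} {f = false} _   (refl , refl , refl) = refl , refl , refl
Insertion-step {u} {f = true}  _   (refl , refl , refl) = refl , refl , refl
Insertion-step {d} {f = false} _   (refl , refl , refl) = refl , refl , refl
Insertion-step {d} {f = true}  _   (refl , refl , refl) = refl , refl , refl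
Insertion-step {v} {f = false} _   (refl , refl , refl) = refl , refl , refl
Insertion-step {v} {f = true}  _   (refl , refl , refl) = refl , refl , refl
Insertion-step {h}             h≢h _                    = ⊥-elim (h≢h refl)

insertions-sound : ∀ s T i f {w} → w ∈ insertions s T i f → Insertion T i f s w
flatFirst-sound  : ∀ s T i f {w} → w ∈ flatFirst s T i f → Insertion T i f s w
stepFirst-sound  : ∀ s T i f {w} → w ∈ stepFirst s T i → Insertion T i f s w

insertions-sound s T i f w∈ with ∈-++⁻ (stepFirst s T i) w∈
... | inj₁ w∈s = stepFirst-sound s T i f w∈s
... | inj₂ w∈f = flatFirst-sound s T i f w∈f

flatFirst-sound s (suc T) i       false w∈ with ∈-map⁻ (h ∷_) w∈
... | w′ , w′∈ , refl = Insertion-h {f = false} {w = w′} (insertions-sound s T i false w′∈)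
flatFirst-sound s (suc T) (suc i) true  w∈ with ∈-map⁻ (h ∷_) w∈
... | w′ , w′∈ , refl = Insertion-h {f = true} {w = w′} (insertions-sound s T i false w′∈)

stepFirst-sound []      zero    zero    false (here refl) = refl , refl , refl
stepFirst-sound []      zero    zero    true  (here refl) = refl , refl , refl
stepFirst-sound (u ∷ s) T       i       f     w∈ with ∈-map⁻ (u ∷_) w∈
... | w′ , w′∈ , refl = Insertion-step {f = f} {w = w′} (λ ()) (insertions-sound s T i true w′∈)
stepFirst-sound (d ∷ s) T       i       f     w∈ with ∈-map⁻ (d ∷_) w∈
... | w′ , w′∈ , refl = Insertion-step {f = f} {w = w′} (λ ()) (insertions-sound s T i false w′∈)
stepFirst-sound (v ∷ s) T       i       f     w∈ with ∈-map⁻ (v ∷_) w∈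
... | w′ , w′∈ , refl = Insertion-step {f = f} {w = w′} (λ ()) (insertions-sound s T i false w′∈)

insertions-complete : ∀ f w → w ∈ insertions (dropFlats w) (flats w) (countUH (if f then u ∷ w else w)) f
insertions-complete false []      = here refl
insertions-complete true  []      = here refl
insertions-complete false (h ∷ w) = ∈-++⁺ʳ (stepFirst (dropFlats w) (suc (flats w)) (countUH w))
                                           (∈-map⁺ (h ∷_) (insertions-complete false w))
insertions-complete true  (h ∷ w) = ∈-++⁺ʳ (stepFirst (dropFlats w) (suc (flats w)) (suc (countUH w)))
                                           (∈-map⁺ (h ∷_) (insertions-complete false w))
insertions-complete false (u ∷ w) = ∈-++⁺ˡ (∈-map⁺ (u ∷_) (insertions-complete true w))
insertions-complete true  (u ∷ w) = ∈-++⁺ˡ (∈-map⁺ (u ∷_) (insertions-complete true w))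
insertions-complete false (d ∷ w) = ∈-++⁺ˡ (∈-map⁺ (d ∷_) (insertions-complete false w))
insertions-complete true  (d ∷ w) = ∈-++⁺ˡ (∈-map⁺ (d ∷_) (insertions-complete false w))
insertions-complete false (v ∷ w) = ∈-++⁺ˡ (∈-map⁺ (v ∷_) (insertions-complete false w))
insertions-complete true  (v ∷ w) = ∈-++⁺ˡ (∈-map⁺ (v ∷_) (insertions-complete false w))

flatFirst-head : ∀ s T i f {w} → w ∈ flatFirst s T i f → head w ≡ just h
flatFirst-head s (suc T) i       false w∈ with ∈-map⁻ (h ∷_) w∈
... | _ , _ , refl = refl
flatFirst-head s (suc T) (suc i) true  w∈ with ∈-map⁻ (h ∷_) w∈
... | _ , _ , refl = refl

stepFirst-head : ∀ s T i {w} → w ∈ stepFirst s T i → head w ≢ just h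
stepFirst-head []      zero zero (here refl) ()
stepFirst-head (u ∷ s) T    i    w∈ with ∈-map⁻ (u ∷_) w∈
... | _ , _ , refl = λ ()
stepFirst-head (d ∷ s) T    i    w∈ with ∈-map⁻ (d ∷_) w∈
... | _ , _ , refl = λ ()
stepFirst-head (v ∷ s) T    i    w∈ with ∈-map⁻ (v ∷_) w∈
... | _ , _ , refl = λ ()

Unique-insertions : ∀ s T i f → Unique (insertions s T i f)
Unique-flatFirst  : ∀ s T i f → Unique (flatFirst s T i f)
Unique-stepFirst  : ∀ s T i → Unique (stepFirst s T i)

Unique-insertions s T i f =
  Unique.++⁺ (Unique-stepFirst s T i) (Unique-flatFirst s T i f)
    λ (p , q) → stepFirst-head s T i p (flatFirst-head s T i f q)

Unique-flatFirst s zero    i       f     = []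
Unique-flatFirst s (suc T) i       false = Unique-map-∷ h (Unique-insertions s T i false)
Unique-flatFirst s (suc T) zero    true  = []
Unique-flatFirst s (suc T) (suc i) true  = Unique-map-∷ h (Unique-insertions s T i false)

Unique-stepFirst []      zero    zero    = [] ∷ []
Unique-stepFirst []      zero    (suc i) = []
Unique-stepFirst []      (suc T) i       = []
Unique-stepFirst (u ∷ s) T       i       = Unique-map-∷ u (Unique-insertions s T i true)
Unique-stepFirst (d ∷ s) T       i       = Unique-map-∷ d (Unique-insertions s T i false)
Unique-stepFirst (h ∷ s) T       i       = []
Unique-stepFirst (v ∷ s) T       i       = Unique-map-∷ v (Unique-insertions s T i false)

insertions-enumerates : ∀ s T i f → Enumerates (Insertion T i f s) (insertions s T i f)
insertions-enumerates s T i f = record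
  { unique   = Unique-insertions s T i f
  ; sound    = insertions-sound s T i f
  ; complete = λ { (refl , refl , refl) → insertions-complete f _ }
  }

-- Flat steps go into the gaps after the descents of s, before s (unless the flag is
-- set), and after i chosen up steps, whose gaps must be nonempty.
length-stepFirst         : ∀ s T i → All (_≢ h) s →
                           length (stepFirst s T i) ≡ (ups s C i) * placements (descents s + i) i T
length-insertions        : ∀ s T i → All (_≢ h) s →
                           length (insertions s T i false) ≡ (ups s C i) * placements (suc (descents s + i)) i T
length-insertions-afterU : ∀ s T i → All (_≢ h) s →
                           length (insertions s T i true) ≡ (suc (ups s) C i) * placements (descents s + i) i T

length-stepFirst []      zero    zero    []         = refl
length-stepFirst []      zero    (suc i) []         = sym (*-zeroʳ (0 C suc i))
length-stepFirst []      (suc T) zero    []         = refl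
length-stepFirst []      (suc T) (suc i) []         = refl
length-stepFirst (u ∷ s) T       i       (_ ∷ nf)   =
  trans (length-map (u ∷_) (insertions s T i true)) (length-insertions-afterU s T i nf)
length-stepFirst (d ∷ s) T       i       (_ ∷ nf)   =
  trans (length-map (d ∷_) (insertions s T i false)) (length-insertions s T i nf)
length-stepFirst (v ∷ s) T       i       (_ ∷ nf)   =
  trans (length-map (v ∷_) (insertions s T i false)) (length-insertions s T i nf)
length-stepFirst (h ∷ s) T       i       (h≢h ∷ _) = ⊥-elim (h≢h refl)

length-insertions s zero i nf = begin
  length (stepFirst s 0 i ++ [])        ≡⟨ cong length (++-identityʳ (stepFirst s 0 i)) ⟩
  length (stepFirst s 0 i)              ≡⟨ length-stepFirst s 0 i nf ⟩
  (ups s C i) * placements p i 0        ≡⟨ cong ((ups s C i) *_) (placements-empty p (suc p) i) ⟩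
  (ups s C i) * placements (suc p) i 0  ∎
  where p = descents s + i
length-insertions s (suc T) i nf = begin
  length (stepFirst s (suc T) i ++ map (h ∷_) (insertions s T i false))
    ≡⟨ length-++ (stepFirst s (suc T) i) ⟩
  length (stepFirst s (suc T) i) + length (map (h ∷_) (insertions s T i false))
    ≡⟨ cong₂ _+_ (length-stepFirst s (suc T) i nf)
                 (trans (length-map (h ∷_) (insertions s T i false)) (length-insertions s T i nf)) ⟩
  c * placements p i (suc T) + c * placements (suc p) i T
    ≡⟨ *-distribˡ-+ c _ _ ⟨
  c * (placements p i (suc T) + placements (suc p) i T)
    ≡⟨ cong (c *_) (trans (+-comm (placements p i (suc T)) _) (sym (placements-pascal p i T))) ⟩
  c * placements (suc p) i (suc T)
    ∎
  where
  c = ups s C i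
  p = descents s + i

length-insertions-afterU s zero    zero    nf =
  trans (cong length (++-identityʳ (stepFirst s 0 0))) (length-stepFirst s 0 0 nf)
length-insertions-afterU s zero    (suc i) nf =
  trans (cong length (++-identityʳ (stepFirst s 0 (suc i))))
        (trans (length-stepFirst s 0 (suc i) nf) (trans (*-zeroʳ (ups s C suc i)) (sym (*-zeroʳ (suc (ups s) C suc i)))))
length-insertions-afterU s (suc T) zero    nf =
  trans (cong length (++-identityʳ (stepFirst s (suc T) 0))) (length-stepFirst s (suc T) 0 nf)
length-insertions-afterU s (suc T) (suc i) nf = begin
  length (stepFirst s (suc T) (suc i) ++ map (h ∷_) (insertions s T i false))
    ≡⟨ length-++ (stepFirst s (suc T) (suc i)) ⟩
  length (stepFirst s (suc T) (suc i)) + length (map (h ∷_) (insertions s T i false))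
    ≡⟨ cong₂ _+_ (length-stepFirst s (suc T) (suc i) nf)
                 (trans (length-map (h ∷_) (insertions s T i false)) (length-insertions s T i nf)) ⟩
  (K C suc i) * placements (e + suc i) i T + (K C i) * placements (suc (e + i)) i T
    ≡⟨ cong (λ p → (K C suc i) * placements p i T + (K C i) * P) (+-suc e i) ⟩
  (K C suc i) * P + (K C i) * P
    ≡⟨ *-distribʳ-+ P (K C suc i) (K C i) ⟨
  (K C suc i + K C i) * P
    ≡⟨ cong (_* P) (trans (+-comm (K C suc i) (K C i)) (nCk+nC[k+1]≡[n+1]C[k+1] K i)) ⟩
  (suc K C suc i) * P
    ≡⟨ cong (λ p → (suc K C suc i) * placements p i T) (+-suc e i) ⟨
  (suc K C suc i) * placements (e + suc i) i T
    ∎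
  where
  K = ups s
  e = descents s
  P = placements (suc (e + i)) i T

-- Decomposing G-Motzkin paths

m≡n+o⇒m∸n≡o : ∀ {m} n o → m ≡ n + o → m ∸ n ≡ o
m≡n+o⇒m∸n≡o n o refl = m+n∸m≡n n o

module Slack {n k i j r : ℕ} (n≡ : n ≡ k + i + j + r) where

  private
    reorder₁ : ∀ k i j r → k + i + j + r ≡ i + (k + (j + r))
    reorder₁ = solve-∀
    reorder₂ : ∀ k i j r → k + i + j + r ≡ k + (j + (i + r))
    reorder₂ = solve-∀
    reorder₃ : ∀ k i j r → k + i + j + r ≡ j + (r + (k + i))
    reorder₃ = solve-∀
    reorder₄ : ∀ k i j r → k + i + j + r ≡ k + (i + (j + r))
    reorder₄ = solve-∀

  n∸i≡k+[j+r] : n ∸ i ≡ k + (j + r)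
  n∸i≡k+[j+r] = m≡n+o⇒m∸n≡o i _ (trans n≡ (reorder₁ k i j r))

  n∸k∸i≡j+r : n ∸ k ∸ i ≡ j + r
  n∸k∸i≡j+r = m≡n+o⇒m∸n≡o i _ (m≡n+o⇒m∸n≡o k _ (trans n≡ (reorder₄ k i j r)))

  n∸k∸j≡i+r : n ∸ k ∸ j ≡ i + r
  n∸k∸j≡i+r = m≡n+o⇒m∸n≡o j _ (m≡n+o⇒m∸n≡o k _ (trans n≡ (reorder₂ k i j r)))

  n∸j≡r+[k+i] : n ∸ j ≡ r + (k + i)
  n∸j≡r+[k+i] = m≡n+o⇒m∸n≡o j _ (trans n≡ (reorder₃ k i j r))

  n∸k∸i∸j≡r : n ∸ k ∸ i ∸ j ≡ r
  n∸k∸i∸j≡r = m≡n+o⇒m∸n≡o j r n∸k∸i≡j+r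

range-slack : ∀ {n k i j} → i ≤ k → k ≤ n ∸ i → j ≤ n ∸ k ∸ i → ∃[ r ] n ≡ k + i + j + r
range-slack {n} {k} {i} {j} i≤k k≤n∸i j≤n∸k∸i =
  let r , j+[k+i]+r≡n = m≤n⇒∃[o]m+o≡n j+[k+i]≤n in r , trans (sym j+[k+i]+r≡n) (reorder j k i r)
  where
  k+i≤n : k + i ≤ n
  k+i≤n = m≤o∸n⇒m+n≤o k (≤-trans i≤k (≤-trans k≤n∸i (m∸n≤m n i))) k≤n∸i
  j+[k+i]≤n : j + (k + i) ≤ n
  j+[k+i]≤n = m≤o∸n⇒m+n≤o j k+i≤n (subst (j ≤_) (∸-+-assoc n k i) j≤n∸k∸i)
  reorder : ∀ j k i r → j + (k + i) + r ≡ k + i + j + r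
  reorder = solve-∀

ColouredDyck : ℕ → ℕ → List Step → Set
ColouredDyck k j s = ∃[ D ] Ballot 0 k D × Colouring j D s

colouredDyckPaths : ℕ → ℕ → List (List Step)
colouredDyckPaths k j = concatMap (λ D → colourings D j) (ballotPaths 0 k)

colouredDyckPaths-enumerates : ∀ k j → Enumerates (ColouredDyck k j) (colouredDyckPaths k j)
colouredDyckPaths-enumerates k j =
  concatMap-enumerates (ballotPaths-enumerates 0 k) (λ D → colourings-enumerates D j)
    λ (D≡ , _) (D′≡ , _) → trans (sym D≡) D′≡

length-colouredDyckPaths : ∀ k j → length (colouredDyckPaths k j) ≡ catalan k * (k C j)
length-colouredDyckPaths k j =
  trans (length-concatMap-const {F = λ D → colourings D j} (ballotPaths 0 k) colourings-of-dyck)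
        (cong (_* (k C j)) (length-dyckPaths k))
  where
  colourings-of-dyck : ∀ {D} → D ∈ ballotPaths 0 k → length (colourings D j) ≡ k C j
  colourings-of-dyck D∈ with ballotPaths-sound 0 k D∈
  ... | walk , ud , refl = trans (length-colourings j ud) (cong (_C j) (sym (Walk⇒height+ups≡descents walk)))

length-insertions-colouredDyck : ∀ {k j s} T i → ColouredDyck k j s →
  length (insertions s T i false) ≡ (k C i) * placements (suc (k + i)) i T
length-insertions-colouredDyck {s = s} T i (_ , (walk , _ , refl) , (refl , nf , _)) =
  trans (length-insertions s T i nf)
        (cong₂ (λ a b → (a C i) * placements (suc (b + i)) i T)
               (sym (ups-recolour s))
               (trans (sym (descents-recolour s)) (sym (Walk⇒height+ups≡descents walk))))

module _ (n i : ℕ) where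

  Decomposedₖⱼ : ℕ → ℕ → List Step → Set
  Decomposedₖⱼ k j w = ∃[ s ] ColouredDyck k j s × Insertion (n ∸ k ∸ j) i false s w

  Decomposedₖ : ℕ → List Step → Set
  Decomposedₖ k w = ∃[ j ] (0 ≤ j × j ≤ n ∸ k ∸ i) × Decomposedₖⱼ k j w

  Decomposed : List Step → Set
  Decomposed w = ∃[ k ] (i ≤ k × k ≤ n ∸ i) × Decomposedₖ k w

  pathsₖⱼ : ℕ → ℕ → List (List Step)
  pathsₖⱼ k j = concatMap (λ s → insertions s (n ∸ k ∸ j) i false) (colouredDyckPaths k j)

  pathsₖ : ℕ → List (List Step)
  pathsₖ k = concatMap (pathsₖⱼ k) (range 0 (n ∸ k ∸ i))

  paths : List (List Step)
  paths = concatMap pathsₖ (range i (n ∸ i))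

  pathsₖⱼ-enumerates : ∀ k j → Enumerates (Decomposedₖⱼ k j) (pathsₖⱼ k j)
  pathsₖⱼ-enumerates k j =
    concatMap-enumerates (colouredDyckPaths-enumerates k j) (λ s → insertions-enumerates s (n ∸ k ∸ j) i false)
      λ (s≡ , _) (s′≡ , _) → trans (sym s≡) s′≡

  Decomposedₖⱼ⇒downs : ∀ {k j} w → Decomposedₖⱼ k j w → downs (dropFlats w) ≡ j
  Decomposedₖⱼ⇒downs _ (_ , (_ , _ , (_ , _ , refl)) , (refl , _)) = refl

  pathsₖ-enumerates : ∀ k → Enumerates (Decomposedₖ k) (pathsₖ k)
  pathsₖ-enumerates k =
    concatMap-enumerates (range-enumerates 0 (n ∸ k ∸ i)) (pathsₖⱼ-enumerates k)
      λ {_} {_} {w} p q → trans (sym (Decomposedₖⱼ⇒downs w p)) (Decomposedₖⱼ⇒downs w q)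

  Decomposedₖ⇒ups : ∀ {k} w → Decomposedₖ k w → ups (recolour (dropFlats w)) ≡ k
  Decomposedₖ⇒ups _ (_ , _ , _ , (_ , (_ , _ , refl) , (refl , _)) , (refl , _)) = refl

  paths-enumerates : Enumerates Decomposed paths
  paths-enumerates =
    concatMap-enumerates (range-enumerates i (n ∸ i)) pathsₖ-enumerates
      λ {_} {_} {w} p q → trans (sym (Decomposedₖ⇒ups w p)) (Decomposedₖ⇒ups w q)

  term : ℕ → ℕ → ℕ
  term k j = (k C i) * (k C j) * ((n ∸ j) C (n ∸ k ∸ i ∸ j)) * catalan k

  length-pathsₖⱼ : ∀ {k j} → i ≤ k → k ≤ n ∸ i → j ≤ n ∸ k ∸ i → length (pathsₖⱼ k j) ≡ term k j
  length-pathsₖⱼ {k} {j} i≤k k≤n∸i j≤n∸k∸i = begin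
    length (pathsₖⱼ k j)
      ≡⟨ length-concatMap-const {F = λ s → insertions s (n ∸ k ∸ j) i false} (colouredDyckPaths k j)
           (length-insertions-colouredDyck (n ∸ k ∸ j) i ∘ sound (colouredDyckPaths-enumerates k j)) ⟩
    length (colouredDyckPaths k j) * ((k C i) * placements (suc (k + i)) i (n ∸ k ∸ j))
      ≡⟨ cong₂ (λ a b → a * ((k C i) * b)) (length-colouredDyckPaths k j) placements≡C ⟩
    catalan k * (k C j) * ((k C i) * ((n ∸ j) C (n ∸ k ∸ i ∸ j)))
      ≡⟨ reorder (catalan k) (k C j) (k C i) _ ⟩
    term k j
      ∎
    where
    slack : ∃[ r ] n ≡ k + i + j + r
    slack = range-slack i≤k k≤n∸i j≤n∸k∸i
    r : ℕ
    r = proj₁ slack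
    open Slack {n} {k} {i} {j} {r} (proj₂ slack)
    placements≡C : placements (suc (k + i)) i (n ∸ k ∸ j) ≡ (n ∸ j) C (n ∸ k ∸ i ∸ j)
    placements≡C = begin
      placements (suc (k + i)) i (n ∸ k ∸ j)  ≡⟨ cong (placements (suc (k + i)) i) n∸k∸j≡i+r ⟩
      placements (suc (k + i)) i (i + r)      ≡⟨ placements-reserved (suc (k + i)) i r ⟩
      multichoose (suc (k + i)) r             ≡⟨ multichoose[1+p]≡C (k + i) r ⟩
      (r + (k + i)) C r                       ≡⟨ cong₂ _C_ (sym n∸j≡r+[k+i]) (sym n∸k∸i∸j≡r) ⟩
      (n ∸ j) C (n ∸ k ∸ i ∸ j)               ∎
    reorder : ∀ c x y z → c * x * (y * z) ≡ y * x * z * c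
    reorder = solve-∀

  length-pathsₖ : ∀ {k} → i ≤ k → k ≤ n ∸ i → length (pathsₖ k) ≡ sumFromTo 0 (n ∸ k ∸ i) (term k)
  length-pathsₖ {k} i≤k k≤n∸i =
    trans (length-concatMap {F = pathsₖⱼ k} (range 0 (n ∸ k ∸ i))
             λ j∈ → length-pathsₖⱼ i≤k k≤n∸i (proj₂ (sound (range-enumerates 0 (n ∸ k ∸ i)) j∈)))
          (sum-map-range (term k) 0 (n ∸ k ∸ i))

  length-paths : length paths ≡ rhs n i
  length-paths =
    trans (length-concatMap {F = pathsₖ} (range i (n ∸ i))
             λ k∈ → let i≤k , k≤n∸i = sound (range-enumerates i (n ∸ i)) k∈ in length-pathsₖ i≤k k≤n∸i)
          (sum-map-range (λ k → sumFromTo 0 (n ∸ k ∸ i) (term k)) i (n ∸ i))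

  decompose : ∀ {w} → GMotzkin n w → countUH w ≡ i → Decomposed w
  decompose {w} (walk , xlength≡n) countUH≡i =
    ups w , (i≤k , k≤n∸i) , downs w , (z≤n , j≤n∸k∸i) , dropFlats w ,
    (recolour (dropFlats w) ,
      (Walk-recolour⁺ _ (Walk-dropFlats⁺ w walk) , All-UpOrDown-recolour-dropFlats w ,
       trans (ups-recolour (dropFlats w)) (ups-dropFlats w)) ,
      (refl , All-≢h-dropFlats w , downs-dropFlats w)) ,
    (refl , flats≡ , countUH≡i)
    where
    i≤k : i ≤ ups w
    i≤k = subst (_≤ ups w) countUH≡i (countUH≤ups w)
    slack : ∃[ r ] i + r ≡ flats w
    slack = m≤n⇒∃[o]m+o≡n (subst (_≤ flats w) countUH≡i (countUH≤flats w))
    r : ℕ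
    r = proj₁ slack
    reorder : ∀ k j i r → k + j + (i + r) ≡ k + i + j + r
    reorder = solve-∀
    open Slack {n} {ups w} {i} {downs w} {r} (begin
      n                                 ≡⟨ sym xlength≡n ⟩
      xlength w                         ≡⟨ xlength≡ups+downs+flats w ⟩
      ups w + downs w + flats w         ≡⟨ cong (ups w + downs w +_) (proj₂ slack) ⟨
      ups w + downs w + (i + r)         ≡⟨ reorder (ups w) (downs w) i r ⟩
      ups w + i + downs w + r           ∎)
    k≤n∸i : ups w ≤ n ∸ i
    k≤n∸i = subst (ups w ≤_) (sym n∸i≡k+[j+r]) (m≤m+n (ups w) _)
    j≤n∸k∸i : downs w ≤ n ∸ ups w ∸ i
    j≤n∸k∸i = subst (downs w ≤_) (sym n∸k∸i≡j+r) (m≤m+n (downs w) r)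
    flats≡ : flats w ≡ n ∸ ups w ∸ downs w
    flats≡ = trans (sym (proj₂ slack)) (sym n∸k∸j≡i+r)

  recompose : ∀ {w} → Decomposed w → GMotzkin n w × countUH w ≡ i
  recompose {w} (k , (i≤k , k≤n∸i) , j , (_ , j≤n∸k∸i) , _ , (_ , (walk , _ , ups≡k) , (refl , _ , downs≡j)) ,
                 (refl , flats≡ , countUH≡i)) =
    (Walk-dropFlats⁻ w (Walk-recolour⁻ (dropFlats w) walk) , xlength≡n) , countUH≡i
    where
    slack : ∃[ r ] n ≡ k + i + j + r
    slack = range-slack i≤k k≤n∸i j≤n∸k∸i
    r : ℕ
    r = proj₁ slack
    open Slack {n} {k} {i} {j} {r} (proj₂ slack)
    reorder : ∀ k j i r → k + j + (i + r) ≡ k + i + j + r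
    reorder = solve-∀
    xlength≡n : xlength w ≡ n
    xlength≡n = begin
      xlength w                    ≡⟨ xlength≡ups+downs+flats w ⟩
      ups w + downs w + flats w    ≡⟨ cong₂ (λ a b → a + b + flats w)
                                            (trans (sym (trans (ups-recolour (dropFlats w)) (ups-dropFlats w))) ups≡k)
                                            (trans (sym (downs-dropFlats w)) downs≡j) ⟩
      k + j + flats w              ≡⟨ cong (k + j +_) (trans flats≡ n∸k∸j≡i+r) ⟩
      k + j + (i + r)              ≡⟨ reorder k j i r ⟩
      k + i + j + r                ≡⟨ proj₂ slack ⟨
      n                            ∎

theorem4p4 : (n i : ℕ) → i ≤ n →
    Σ (List (List Step)) λ ps →
    Unique ps ×
    All (λ w → GMotzkin n w × countUH w ≡ i) ps ×
    ((w : List Step) → GMotzkin n w → countUH w ≡ i → w ∈ ps) ×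
    length ps ≡ rhs n i
theorem4p4 n i _ =
  paths n i ,
  unique (paths-enumerates n i) ,
  All.tabulate (recompose n i ∘ sound (paths-enumerates n i)) ,
  (λ w gmotzkin countUH≡i → complete (paths-enumerates n i) (decompose n i gmotzkin countUH≡i)) ,
  length-paths n i
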